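{- Let $m\ge 2$ and $n\ge 2$. Then $\mathrm{f}\mu^{k}(K_m\,\square\,K_n)=z(m,n;2,2)$ if $k=0$, $\mathrm{f}\mu^{k}(K_m\,\square\,K_n)=m+n-2$ if $k=1$, and $\mathrm{f}\mu^{k}(K_m\,\square\,K_n)=\max\{m,n\}$ if $k\ge 2$.
   Context: For an integer $k\ge 0$ and a connected graph $G$, a set $X\subseteq V(G)$ is a $k$-fault-tolerant mutual-visibility set ($k$-ftmv set) if for any two non-adjacent vertices $u,v\in X$ there exist $k+1$ internally vertex-disjoint shortest $u,v$-paths $Q_1,\dots,Q_{k+1}$ in $G$ such that $V(Q_i)\cap X=\{u,v\}$ for every $i$. $\mathrm{f}\mu^{k}(G)$ denotes the maximum cardinality of a $k$-ftmv set of $G$. $K_n$ is the complete graph on $n$ vertices and $G\,\square\,H$ is the Cartesian product: vertex set $V(G)\times V(H)$, with $(g,h)\sim(g',h')$ iff either $g=g'$ and $hh'\in E(H)$, or $gg'\in E(G)$ and $h=h'$. $z(m,n;2,2)$ is the maximum number of entries equal to $1$ in an $m\times n$ binary matrix that contains no $2\times 2$ submatrix (formed by any two rows and any two columns) consisting of four $1$s. -}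

module Defs where

open import Data.Nat using (ℕ; zero; suc; _+_; _≤_)
open import Data.Bool using (Bool; true; false; if_then_else_)
open import Data.Fin using (Fin)
open import Data.List using (List; []; _∷_; length; map; allFin)
open import Data.Nat.ListAction using (sum)
open import Data.List.Membership.Propositional using (_∈_)
open import Data.List.Relation.Unary.Unique.Propositional using (Unique)
open import Data.Product using (_×_; Σ; _,_)
open import Data.Sum using (_⊎_)
open import Data.Empty using (⊥)
open import Relation.Binary.PropositionalEquality using (_≡_; _≢_)
open import Relation.Nullary using (¬_)

record Graph : Set₁ where
  field
    V   : Set
    Adj : V → V → Set
open Graph public

K : ℕ → Graph
K n = record { V = Fin n ; Adj = λ x y → x ≢ y }

_□_ : Graph → Graph → Graph
G □ H = record
  { V   = V G × V H
  ; Adj = λ { (g , h) (g' , h') →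
              (g ≡ g' × Adj H h h') ⊎ (Adj G g g' × h ≡ h') } }

module _ (G : Graph) where

  data IsWalk : V G → V G → List (V G) → Set where
    single : ∀ {u} → IsWalk u u (u ∷ [])
    step   : ∀ {u w v xs} → Adj G u w → IsWalk w v xs → IsWalk u v (u ∷ xs)

  -- A shortest u,v-path: a u,v-walk whose length is minimal among all
  -- u,v-walks (such a walk is automatically a path).
  IsShortestPath : V G → V G → List (V G) → Set
  IsShortestPath u v xs =
    IsWalk u v xs × (∀ ys → IsWalk u v ys → length xs ≤ length ys)

  IsFTMV : ℕ → List (V G) → Set
  IsFTMV k X =
    ∀ u v → u ∈ X → v ∈ X → u ≢ v → ¬ Adj G u v →
    Σ (Fin (suc k) → List (V G)) λ Q →
        (∀ i → IsShortestPath u v (Q i))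
      × (∀ i j → i ≢ j → ∀ w → w ∈ Q i → w ∈ Q j → (w ≡ u ⊎ w ≡ v))
      × (∀ i w → w ∈ Q i → w ∈ X → (w ≡ u ⊎ w ≡ v))

  IsFmu : ℕ → ℕ → Set
  IsFmu k r =
      Σ (List (V G)) (λ X → Unique X × IsFTMV k X × length X ≡ r)
    × (∀ X → Unique X → IsFTMV k X → length X ≤ r)

Matrix : ℕ → ℕ → Set
Matrix m n = Fin m → Fin n → Bool

ones : ∀ {m n} → Matrix m n → ℕ
ones {m} {n} M =
  sum (map (λ i → sum (map (λ j → if M i j then 1 else 0) (allFin n))) (allFin m))

RectFree : ∀ {m n} → Matrix m n → Set
RectFree {m} {n} M =
  ∀ (i i' : Fin m) (j j' : Fin n) → i ≢ i' → j ≢ j' →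
  M i j ≡ true → M i j' ≡ true → M i' j ≡ true → M i' j' ≡ true → ⊥

IsZ : ℕ → ℕ → ℕ → Set
IsZ m n z =
    Σ (Matrix m n) (λ M → RectFree M × ones M ≡ z)
  × (∀ (M : Matrix m n) → RectFree M → ones M ≤ z)

-- Two non-adjacent vertices u = (a , b) and v = (a' , b') of K_m □ K_n differ in both
-- coordinates, and their shortest paths are exactly the two paths u, c, v through the corners
-- c = (a , b') and c = (a' , b).  So X is a k-ftmv set iff every such pair in X has k + 1
-- distinct corners outside X.  For k = 0 this says that X contains no rectangle, i.e. X is
-- the support of a matrix counted by z(m,n;2,2).  For k ≥ 2 there are not enough corners, so
-- X has no such pair and lies in one row or column.  For k = 1 it says that X contains no L,
-- i.e. every point of X is alone in its row or in its column; sending each point to such a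
-- line is injective and misses at least two of the m + n lines: if every row is the image of
-- some point, then no point is sent to a column, and vice versa.

module Submission where

open import Defs
open import Data.Bool using (Bool; true; false; if_then_else_; T)
open import Data.Bool.Properties using (T-≡)
open import Data.Empty using (⊥-elim)
open import Data.Fin using (Fin; zero; suc; _≟_)
open import Data.Fin.Properties using (suc-injective; injective⇒≤; all?; any?)
open import Data.List using (List; []; _∷_; [_]; _++_; length; map; filter; filterᵇ; allFin; cartesianProduct)
open import Data.List.Extrema.Nat using (argmax; argmax-all; f[xs]≤f[argmax])
open import Data.List.Membership.Propositional using (_∈_; _∉_; find)
open import Data.List.Membership.Propositional.Properties using (∈-++⁺ˡ; ∈-++⁺ʳ; ∈-++⁻; ∈-map⁺; ∈-map⁻; ∈-∃++; ∈-filter⁺; ∈-filter⁻; ∈-allFin; ∈-cartesianProduct⁺)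
open import Data.List.Properties using (length-++; length-map; length-tabulate; filter-++; map-∘)
open import Data.List.Relation.Binary.Subset.Propositional using (_⊆_)
open import Data.List.Relation.Unary.All as All using (All; []; _∷_)
open import Data.List.Relation.Unary.All.Properties using (all-filter; ¬All⇒Any¬) renaming (map⁺ to All-map⁺)
open import Data.List.Relation.Unary.AllPairs using ([]; _∷_)
open import Data.List.Relation.Unary.Any using (here; there)
open import Data.List.Relation.Unary.Unique.Propositional using (Unique)
open import Data.List.Relation.Unary.Unique.Propositional.Properties using (allFin⁺; cartesianProduct⁺; filter⁺; map⁺; ++⁺)
open import Data.Nat using (ℕ; zero; suc; _+_; _∸_; _⊔_; _≤_; z≤n; s≤s)
open import Data.Nat.ListAction using (sum)
open import Data.Nat.Properties using (+-suc; +-comm; ≤-trans; ≤-antisym; ⊔-sel; m≤m⊔n; m≤n⊔m; m+n≤o⇒m≤o∸n; module ≤-Reasoning)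
open import Data.Product using (_×_; _,_; Σ; ∃; proj₁; proj₂; uncurry)
open import Data.Product.Properties using (≡-dec)
open import Data.Sum using (_⊎_; inj₁; inj₂)
open import Data.Sum.Properties using (inj₁-injective; inj₂-injective) renaming (≡-dec to ≡-dec-⊎)
open import Function using (_∘_; id)
open import Function.Bundles using (_⇔_; mk⇔; Equivalence)
open import Function.Definitions using (Injective)
open import Relation.Binary.Definitions using (DecidableEquality)
open import Relation.Binary.PropositionalEquality using (_≡_; _≢_; refl; sym; trans; cong; cong₂; subst; ≢-sym; module ≡-Reasoning)
open import Relation.Nullary using (¬_; Dec; yes; no; ¬?; does; _×-dec_; _→-dec_)
open import Relation.Nullary.Decidable using (isYes; T?; toWitness; fromWitness; map′)
open import Relation.Unary using (Decidable)

length-allFin : ∀ k → length (allFin k) ≡ k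
length-allFin k = length-tabulate id

module _ {A : Set} where

  length-≤-of-⊆ : ∀ {xs ys : List A} → Unique xs → xs ⊆ ys → length xs ≤ length ys
  length-≤-of-⊆ {[]} _ _ = z≤n
  length-≤-of-⊆ {x ∷ xs} {ys} (x∉xs ∷ xs!) xs⊆ys with ∈-∃++ (xs⊆ys (here refl))
  ... | as , bs , refl = begin
    suc (length xs)          ≤⟨ s≤s (length-≤-of-⊆ xs! xs⊆as++bs) ⟩
    suc (length (as ++ bs))  ≡⟨ cong suc (length-++ as) ⟩
    suc (length as + length bs) ≡⟨ +-suc (length as) (length bs) ⟨
    length as + length (x ∷ bs) ≡⟨ length-++ as ⟨
    length (as ++ x ∷ bs)    ∎
    where
    open ≤-Reasoning
    xs⊆as++bs : xs ⊆ as ++ bs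
    xs⊆as++bs {y} y∈xs with ∈-++⁻ as (xs⊆ys (there y∈xs))
    ... | inj₁ y∈as = ∈-++⁺ˡ y∈as
    ... | inj₂ (here refl) = ⊥-elim (All.lookup x∉xs y∈xs refl)
    ... | inj₂ (there y∈bs) = ∈-++⁺ʳ as y∈bs

  length-≡-of-⊆-⊇ : ∀ {xs ys : List A} → Unique xs → Unique ys → xs ⊆ ys → ys ⊆ xs →
                    length xs ≡ length ys
  length-≡-of-⊆-⊇ xs! ys! xs⊆ys ys⊆xs =
    ≤-antisym (length-≤-of-⊆ xs! xs⊆ys) (length-≤-of-⊆ ys! ys⊆xs)

  sublists : List A → List (List A)
  sublists []       = [ [] ]
  sublists (x ∷ xs) = sublists xs ++ map (x ∷_) (sublists xs)

  filter∈sublists : ∀ {P : A → Set} (P? : Decidable P) xs → filter P? xs ∈ sublists xs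
  filter∈sublists P? []       = here refl
  filter∈sublists P? (x ∷ xs) with does (P? x)
  ... | true  = ∈-++⁺ʳ (sublists xs) (∈-map⁺ (x ∷_) (filter∈sublists P? xs))
  ... | false = ∈-++⁺ˡ (filter∈sublists P? xs)

  Longest : (List A → Set) → List A → Set
  Longest P xs = Unique xs × P xs × (∀ ys → Unique ys → P ys → length ys ≤ length xs)

  length-filterᵇ : ∀ (p : A → Bool) xs → length (filterᵇ p xs) ≡ sum (map (λ x → if p x then 1 else 0) xs)
  length-filterᵇ p []       = refl
  length-filterᵇ p (x ∷ xs) with p x
  ... | true  = cong suc (length-filterᵇ p xs)
  ... | false = length-filterᵇ p xs

module _ {A B : Set} where

  unique-map : ∀ (f : A → B) {xs} → Unique xs →
               (∀ {x y} → x ∈ xs → y ∈ xs → f x ≡ f y → x ≡ y) → Unique (map f xs)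
  unique-map f []              _   = []
  unique-map f (x∉xs ∷ xs!) inj =
    All-map⁺ (All.tabulate λ y∈xs fx≡fy → All.lookup x∉xs y∈xs (inj (here refl) (there y∈xs) fx≡fy))
    ∷ unique-map f xs! (λ x∈ y∈ → inj (there x∈) (there y∈))

  length-filterᵇ-cartesianProduct : ∀ (p : A × B → Bool) is js →
    length (filterᵇ p (cartesianProduct is js))
      ≡ sum (map (λ i → sum (map (λ j → if p (i , j) then 1 else 0) js)) is)
  length-filterᵇ-cartesianProduct p []       js = refl
  length-filterᵇ-cartesianProduct p (i ∷ is) js = begin
    length (filterᵇ p (row ++ cartesianProduct is js))
      ≡⟨ cong length (filter-++ (T? ∘ p) row (cartesianProduct is js)) ⟩
    length (filterᵇ p row ++ filterᵇ p (cartesianProduct is js))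
      ≡⟨ length-++ (filterᵇ p row) ⟩
    length (filterᵇ p row) + length (filterᵇ p (cartesianProduct is js))
      ≡⟨ cong₂ _+_ (length-filterᵇ p row) (length-filterᵇ-cartesianProduct p is js) ⟩
    sum (map (λ x → if p x then 1 else 0) row) + _
      ≡⟨ cong (λ s → sum s + _) (map-∘ js) ⟨
    sum (map (λ j → if p (i , j) then 1 else 0) js) + _
      ∎
    where
    open ≡-Reasoning
    row : List (A × B)
    row = map (i ,_) js

module _ {A : Set} (_≟_ : DecidableEquality A)
         {universe : List A} (universe! : Unique universe) (∈-universe : ∀ x → x ∈ universe) where
  open import Data.List.Membership.DecPropositional _≟_ using (_∈?_)
  open import Data.List.Relation.Unary.Unique.DecPropositional _≟_ using (unique?)

  longest : ∀ {P : List A → Set} → Decidable P → (∀ {xs ys} → xs ⊆ ys → P ys → P xs) → P [] →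
            Σ (List A) (Longest P)
  longest {P} P? P-⊆ P[] = best , proj₁ best-unique-P , proj₂ best-unique-P , best-longest
    where
    candidates : List (List A)
    candidates = filter (λ xs → unique? xs ×-dec P? xs) (sublists universe)
    best : List A
    best = argmax length [] candidates
    best-unique-P : Unique best × P best
    best-unique-P = argmax-all length {P = λ xs → Unique xs × P xs} ([] , P[])
                      (all-filter (λ xs → unique? xs ×-dec P? xs) (sublists universe))
    best-longest : ∀ ys → Unique ys → P ys → length ys ≤ length best
    best-longest ys ys! Pys =
      ≤-trans (length-≤-of-⊆ ys! ys⊆ys') (All.lookup (f[xs]≤f[argmax] {f = length} [] candidates) ys'∈candidates)
      where
      ys' : List A
      ys' = filter (_∈? ys) universe
      ys⊆ys' : ys ⊆ ys'
      ys⊆ys' {y} = ∈-filter⁺ (_∈? ys) (∈-universe y)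
      ys'∈candidates : ys' ∈ candidates
      ys'∈candidates = ∈-filter⁺ _ (filter∈sublists (_∈? ys) universe)
        (filter⁺ (_∈? ys) universe! , P-⊆ (proj₂ ∘ ∈-filter⁻ (_∈? ys) {xs = universe}) Pys)

module _ {A : Set} where

  length-≤-of-injectiveOn : ∀ {k} (f : A → Fin k) {xs} → Unique xs →
                            (∀ {x y} → x ∈ xs → y ∈ xs → f x ≡ f y → x ≡ y) → length xs ≤ k
  length-≤-of-injectiveOn {k} f {xs} xs! injective = begin
    length xs          ≡⟨ length-map f xs ⟨
    length (map f xs)  ≤⟨ length-≤-of-⊆ (unique-map f xs! injective) (λ {i} _ → ∈-allFin i) ⟩
    length (allFin k)  ≡⟨ length-allFin k ⟩
    k                  ∎
    where open ≤-Reasoning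

distinct-elements : ∀ {k} → 2 ≤ k → Σ (Fin k) λ i → Σ (Fin k) λ j → i ≢ j
distinct-elements (s≤s (s≤s _)) = zero , suc zero , λ ()

module RookGraph (m n : ℕ) where

  open Equivalence using (to; from)

  Rook : Graph
  Rook = K m □ K n

  Point : Set
  Point = Fin m × Fin n

  _≟ₚ_ : DecidableEquality Point
  _≟ₚ_ = ≡-dec _≟_ _≟_

  open import Data.List.Membership.DecPropositional _≟ₚ_ using (_∈?_)

  Apart : Point → Point → Set
  Apart (a , b) (a' , b') = a ≢ a' × b ≢ b'

  apart? : ∀ u v → Dec (Apart u v)
  apart? (a , b) (a' , b') = ¬? (a ≟ a') ×-dec ¬? (b ≟ b')

  apart-sym : ∀ {u v} → Apart u v → Apart v u
  apart-sym (a≢a' , b≢b') = a≢a' ∘ sym , b≢b' ∘ sym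

  apart⇒distinct : ∀ {u v} → Apart u v → u ≢ v
  apart⇒distinct (a≢a' , _) refl = a≢a' refl

  apart⇒nonadjacent : ∀ {u v} → Apart u v → ¬ Adj Rook u v
  apart⇒nonadjacent (a≢a' , _) (inj₁ (a≡a' , _)) = a≢a' a≡a'
  apart⇒nonadjacent (_ , b≢b') (inj₂ (_ , b≡b')) = b≢b' b≡b'

  nonadjacent⇒apart : ∀ {u v} → u ≢ v → ¬ Adj Rook u v → Apart u v
  nonadjacent⇒apart u≢v ¬adj =
      (λ a≡a' → ¬adj (inj₁ (a≡a' , λ b≡b' → u≢v (cong₂ _,_ a≡a' b≡b'))))
    , (λ b≡b' → ¬adj (inj₂ ((λ a≡a' → u≢v (cong₂ _,_ a≡a' b≡b')) , b≡b')))

  corner : Point → Point → Fin 2 → Point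
  corner (a , b) (a' , b') zero       = a  , b'
  corner (a , b) (a' , b') (suc zero) = a' , b

  corner-injective : ∀ {u v} → Apart u v → Injective _≡_ _≡_ (corner u v)
  corner-injective _ {zero}     {zero}     _  = refl
  corner-injective _ {suc zero} {suc zero} _  = refl
  corner-injective (a≢a' , _) {zero}     {suc zero} eq = ⊥-elim (a≢a' (cong proj₁ eq))
  corner-injective (a≢a' , _) {suc zero} {zero}     eq = ⊥-elim (a≢a' (cong proj₁ (sym eq)))

  corner-inner : ∀ {u v} → Apart u v → ∀ c → ¬ (corner u v c ≡ u ⊎ corner u v c ≡ v)
  corner-inner (_ , b≢b') zero       (inj₁ eq) = b≢b' (sym (cong proj₂ eq))
  corner-inner (a≢a' , _) zero       (inj₂ eq) = a≢a' (cong proj₁ eq)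
  corner-inner (a≢a' , _) (suc zero) (inj₁ eq) = a≢a' (sym (cong proj₁ eq))
  corner-inner (_ , b≢b') (suc zero) (inj₂ eq) = b≢b' (cong proj₂ eq)

  cornerPath : Point → Point → Fin 2 → List Point
  cornerPath u v c = u ∷ corner u v c ∷ v ∷ []

  apart⇒3≤length : ∀ {u v xs} → Apart u v → IsWalk Rook u v xs → 3 ≤ length xs
  apart⇒3≤length uv single                       = ⊥-elim (apart⇒distinct uv refl)
  apart⇒3≤length uv (step adj single)            = ⊥-elim (apart⇒nonadjacent uv adj)
  apart⇒3≤length uv (step _ (step _ single))     = s≤s (s≤s (s≤s z≤n))
  apart⇒3≤length uv (step _ (step _ (step _ _))) = s≤s (s≤s (s≤s z≤n))

  cornerPath-shortest : ∀ {u v} → Apart u v → ∀ c → IsShortestPath Rook u v (cornerPath u v c)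
  cornerPath-shortest uv c = walk c uv , λ _ → apart⇒3≤length uv
    where
    walk : ∀ c {u v} → Apart u v → IsWalk Rook u v (cornerPath u v c)
    walk zero       (a≢a' , b≢b') = step (inj₁ (refl , b≢b')) (step (inj₂ (a≢a' , refl)) single)
    walk (suc zero) (a≢a' , b≢b') = step (inj₂ (a≢a' , refl)) (step (inj₁ (refl , b≢b')) single)

  shortest⇒cornerPath : ∀ {u v xs} → Apart u v → IsShortestPath Rook u v xs →
                        ∃ λ c → xs ≡ cornerPath u v c
  shortest⇒cornerPath uv (walk , shortest) = go uv walk (shortest _ (proj₁ (cornerPath-shortest uv zero)))
    where
    go : ∀ {u v xs} → Apart u v → IsWalk Rook u v xs → length xs ≤ 3 → ∃ λ c → xs ≡ cornerPath u v c
    go uv single _ = ⊥-elim (apart⇒distinct uv refl)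
    go uv (step adj single) _ = ⊥-elim (apart⇒nonadjacent uv adj)
    go uv (step (inj₁ (refl , _)) (step (inj₂ (_ , refl)) single)) _ = zero , refl
    go uv (step (inj₂ (_ , refl)) (step (inj₁ (refl , _)) single)) _ = suc zero , refl
    go (a≢a' , _) (step (inj₁ (refl , _)) (step (inj₁ (refl , _)) single)) _ = ⊥-elim (a≢a' refl)
    go (_ , b≢b') (step (inj₂ (_ , refl)) (step (inj₂ (_ , refl)) single)) _ = ⊥-elim (b≢b' refl)
    go uv (step _ (step _ (step _ single)))       (s≤s (s≤s (s≤s ())))
    go uv (step _ (step _ (step _ (step _ _)))) (s≤s (s≤s (s≤s ())))

  FreeCorners : ℕ → List Point → Point → Point → Set
  FreeCorners k X u v = Σ (Fin (suc k) → Fin 2) λ c → Injective _≡_ _≡_ c × (∀ i → corner u v (c i) ∉ X)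

  ftmv⇒freeCorners : ∀ {k X u v} → IsFTMV Rook k X → u ∈ X → v ∈ X → Apart u v →
                     FreeCorners k X u v
  ftmv⇒freeCorners {k} {X} {u} {v} ftmv u∈X v∈X uv
    with Q , shortest , disjoint , avoids ← ftmv _ _ u∈X v∈X (apart⇒distinct uv) (apart⇒nonadjacent uv)
    = c , c-injective , c-free
    where
    via : ∀ i → ∃ λ c → Q i ≡ cornerPath u v c
    via i = shortest⇒cornerPath uv (shortest i)
    c : Fin (suc k) → Fin 2
    c i = proj₁ (via i)
    corner∈Q : ∀ {i d} → c i ≡ d → corner u v d ∈ Q i
    corner∈Q {i} refl = subst (corner u v (c i) ∈_) (sym (proj₂ (via i))) (there (here refl))
    c-injective : Injective _≡_ _≡_ c
    c-injective {i} {j} ci≡cj with i ≟ j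
    ... | yes i≡j = i≡j
    ... | no i≢j  = ⊥-elim (corner-inner uv (c i) (disjoint i j i≢j _ (corner∈Q refl) (corner∈Q (sym ci≡cj))))
    c-free : ∀ i → corner u v (c i) ∉ X
    c-free i corner∈X = corner-inner uv (c i) (avoids i _ (corner∈Q refl) corner∈X)

  freeCorners⇒ftmv : ∀ {k X} → (∀ {u v} → u ∈ X → v ∈ X → Apart u v → FreeCorners k X u v) →
                     IsFTMV Rook k X
  freeCorners⇒ftmv {k} {X} free u v u∈X v∈X u≢v ¬adj
    with c , c-injective , c-free ← free u∈X v∈X (nonadjacent⇒apart u≢v ¬adj)
    = cornerPath u v ∘ c , cornerPath-shortest uv ∘ c , disjoint , avoids
    where
    uv : Apart u v
    uv = nonadjacent⇒apart u≢v ¬adj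
    disjoint : ∀ i j → i ≢ j → ∀ w → w ∈ cornerPath u v (c i) → w ∈ cornerPath u v (c j) → w ≡ u ⊎ w ≡ v
    disjoint i j i≢j w (here w≡u)                 _                           = inj₁ w≡u
    disjoint i j i≢j w (there (there (here w≡v))) _                           = inj₂ w≡v
    disjoint i j i≢j w (there (here refl))        (here w≡u)                  = inj₁ w≡u
    disjoint i j i≢j w (there (here refl))        (there (here eq))           =
      ⊥-elim (i≢j (c-injective (corner-injective uv eq)))
    disjoint i j i≢j w (there (here refl))        (there (there (here w≡v))) = inj₂ w≡v
    avoids : ∀ i w → w ∈ cornerPath u v (c i) → w ∈ X → w ≡ u ⊎ w ≡ v
    avoids i w (here w≡u)                 _   = inj₁ w≡u
    avoids i w (there (here refl))        w∈X = ⊥-elim (c-free i w∈X)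
    avoids i w (there (there (here w≡v))) _   = inj₂ w≡v

  RectangleFree : List Point → Set
  RectangleFree X = ∀ {u v} → u ∈ X → v ∈ X → Apart u v → corner u v zero ∈ X → corner u v (suc zero) ∉ X

  -- As corner v u zero is corner u v (suc zero), this excludes both corners.
  LFree : List Point → Set
  LFree X = ∀ {u v} → u ∈ X → v ∈ X → Apart u v → corner u v zero ∉ X

  NoApartPair : List Point → Set
  NoApartPair X = ∀ {u v} → u ∈ X → v ∈ X → ¬ Apart u v

  ftmv⇒rectangleFree : ∀ {k X} → IsFTMV Rook k X → RectangleFree X
  ftmv⇒rectangleFree ftmv u∈X v∈X uv c₀∈X c₁∈X
    with c , _ , c-free ← ftmv⇒freeCorners ftmv u∈X v∈X uv
    with c zero | c-free zero
  ... | zero     | c₀∉X = c₀∉X c₀∈X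
  ... | suc zero | c₁∉X = c₁∉X c₁∈X

  rectangleFree⇒ftmv₀ : ∀ {X} → RectangleFree X → IsFTMV Rook 0 X
  rectangleFree⇒ftmv₀ {X} rf = freeCorners⇒ftmv free
    where
    injective-on-Fin1 : ∀ {c : Fin 1 → Fin 2} → Injective _≡_ _≡_ c
    injective-on-Fin1 {x = zero} {y = zero} _ = refl
    free : ∀ {u v} → u ∈ X → v ∈ X → Apart u v → FreeCorners 0 X u v
    free {u} {v} u∈X v∈X uv with corner u v zero ∈? X
    ... | no c₀∉X  = (λ _ → zero)     , injective-on-Fin1 , λ { zero → c₀∉X }
    ... | yes c₀∈X = (λ _ → suc zero) , injective-on-Fin1 , λ { zero → rf u∈X v∈X uv c₀∈X }

  ftmv⇒lFree : ∀ {k X} → IsFTMV Rook (suc k) X → LFree X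
  ftmv⇒lFree ftmv u∈X v∈X uv c₀∈X
    with c , c-injective , c-free ← ftmv⇒freeCorners ftmv u∈X v∈X uv
    with c zero | c (suc zero) | c-free zero | c-free (suc zero) | c-injective {zero} {suc zero}
  ... | zero     | _        | c₀∉X | _    | _        = c₀∉X c₀∈X
  ... | suc zero | zero     | _    | c₀∉X | _        = c₀∉X c₀∈X
  ... | suc zero | suc zero | _    | _    | injective with () ← injective refl

  lFree⇒ftmv₁ : ∀ {X} → LFree X → IsFTMV Rook 1 X
  lFree⇒ftmv₁ lf = freeCorners⇒ftmv λ u∈X v∈X uv →
    id , id , λ { zero → lf u∈X v∈X uv ; (suc zero) → lf v∈X u∈X (apart-sym uv) }

  ftmv⇒noApartPair : ∀ {k X} → IsFTMV Rook (2 + k) X → NoApartPair X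
  ftmv⇒noApartPair ftmv u∈X v∈X uv
    with c , c-injective , _ ← ftmv⇒freeCorners ftmv u∈X v∈X uv
    with s≤s (s≤s ()) ← injective⇒≤ c-injective

  noApartPair⇒ftmv : ∀ {k X} → NoApartPair X → IsFTMV Rook k X
  noApartPair⇒ftmv nap = freeCorners⇒ftmv λ u∈X v∈X uv → ⊥-elim (nap u∈X v∈X uv)

  ¬apart⇒sameRow : ∀ {u v} → ¬ Apart u v → proj₂ u ≢ proj₂ v → proj₁ u ≡ proj₁ v
  ¬apart⇒sameRow {a , _} {a' , _} ¬uv b≢b' with a ≟ a'
  ... | yes a≡a' = a≡a'
  ... | no  a≢a' = ⊥-elim (¬uv (a≢a' , b≢b'))

  ¬apart⇒sameColumn : ∀ {u v} → ¬ Apart u v → proj₁ u ≢ proj₁ v → proj₂ u ≡ proj₂ v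
  ¬apart⇒sameColumn {_ , b} {_ , b'} ¬uv a≢a' with b ≟ b'
  ... | yes b≡b' = b≡b'
  ... | no  b≢b' = ⊥-elim (¬uv (a≢a' , b≢b'))

  noApartPair⇒onLine : ∀ {X x} → NoApartPair X → x ∈ X →
    (∀ {y} → y ∈ X → proj₁ y ≡ proj₁ x) ⊎ (∀ {y} → y ∈ X → proj₂ y ≡ proj₂ x)
  noApartPair⇒onLine {X} {x} nap x∈X with All.all? (λ y → proj₁ y ≟ proj₁ x) X
  ... | yes onRow = inj₁ (All.lookup onRow)
  ... | no ¬onRow with z , z∈X , z-offRow ← find (¬All⇒Any¬ (λ y → proj₁ y ≟ proj₁ x) X ¬onRow) =
    inj₂ onColumn
    where
    z-onColumn : proj₂ z ≡ proj₂ x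
    z-onColumn = ¬apart⇒sameColumn (nap z∈X x∈X) z-offRow
    onColumn : ∀ {y} → y ∈ X → proj₂ y ≡ proj₂ x
    onColumn {y} y∈X with proj₂ y ≟ proj₂ x
    ... | yes y-onColumn = y-onColumn
    ... | no  y-offColumn = ⊥-elim (nap y∈X z∈X
          ( (λ rows≡ → z-offRow (trans (sym rows≡) (¬apart⇒sameRow (nap y∈X x∈X) y-offColumn)))
          , (λ columns≡ → y-offColumn (trans columns≡ z-onColumn))))

  noApartPair⇒length≤ : ∀ {X} → Unique X → NoApartPair X → length X ≤ m ⊔ n
  noApartPair⇒length≤ {[]}    _  _   = z≤n
  noApartPair⇒length≤ {x ∷ _} X! nap with noApartPair⇒onLine nap (here refl)
  ... | inj₁ onRow    = ≤-trans (length-≤-of-injectiveOn proj₂ X! λ y∈X z∈X →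
                          cong₂ _,_ (trans (onRow y∈X) (sym (onRow z∈X)))) (m≤n⊔m m n)
  ... | inj₂ onColumn = ≤-trans (length-≤-of-injectiveOn proj₁ X! λ y∈X z∈X rows≡ →
                          cong₂ _,_ rows≡ (trans (onColumn y∈X) (sym (onColumn z∈X)))) (m≤m⊔n m n)

  Line : Set
  Line = Fin m ⊎ Fin n

  allLines : List Line
  allLines = map inj₁ (allFin m) ++ map inj₂ (allFin n)

  ∈-allLines : ∀ ℓ → ℓ ∈ allLines
  ∈-allLines (inj₁ a) = ∈-++⁺ˡ (∈-map⁺ inj₁ (∈-allFin a))
  ∈-allLines (inj₂ b) = ∈-++⁺ʳ (map inj₁ (allFin m)) (∈-map⁺ inj₂ (∈-allFin b))

  length-allLines : length allLines ≡ m + n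
  length-allLines = begin
    length allLines                                         ≡⟨ length-++ (map inj₁ (allFin m)) ⟩
    length (map inj₁ (allFin m)) + length (map inj₂ (allFin n)) ≡⟨ cong₂ _+_ (length-map inj₁ (allFin m)) (length-map inj₂ (allFin n)) ⟩
    length (allFin m) + length (allFin n)                   ≡⟨ cong₂ _+_ (length-allFin m) (length-allFin n) ⟩
    m + n                                                   ∎
    where open ≡-Reasoning

  AloneInRow : List Point → Point → Set
  AloneInRow X (a , b) = ∀ b' → (a , b') ∈ X → b' ≡ b

  AloneInColumn : List Point → Point → Set
  AloneInColumn X (a , b) = ∀ a' → (a' , b) ∈ X → a' ≡ a

  alone⇒lFree : ∀ {X} → (∀ {x} → x ∈ X → AloneInRow X x ⊎ AloneInColumn X x) → LFree X
  alone⇒lFree alone u∈X v∈X (a≢a' , b≢b') c₀∈X with alone c₀∈X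
  ... | inj₁ aloneInRow    = b≢b' (aloneInRow _ u∈X)
  ... | inj₂ aloneInColumn = a≢a' (sym (aloneInColumn _ v∈X))

  module _ {X : List Point} (lfree : LFree X) where

    aloneInRow? : ∀ x → Dec (AloneInRow X x)
    aloneInRow? (a , b) = all? λ b' → (a , b') ∈? X →-dec b' ≟ b

    aloneInColumn : ∀ {x} → x ∈ X → ¬ AloneInRow X x → AloneInColumn X x
    aloneInColumn {a , b} x∈X ¬alone a' a'b∈X with a' ≟ a
    ... | yes a'≡a = a'≡a
    ... | no  a'≢a = ⊥-elim (¬alone alone)
      where
      alone : AloneInRow X (a , b)
      alone b' ab'∈X with b' ≟ b
      ... | yes b'≡b = b'≡b
      ... | no  b'≢b = ⊥-elim (lfree ab'∈X a'b∈X (a'≢a ∘ sym , b'≢b) x∈X)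

    ownLine : Point → Line
    ownLine (a , b) with aloneInRow? (a , b)
    ... | yes _ = inj₁ a
    ... | no  _ = inj₂ b

    ownLine≡row : ∀ {x a} → ownLine x ≡ inj₁ a → AloneInRow X x × proj₁ x ≡ a
    ownLine≡row {x} eq with aloneInRow? x
    ... | yes alone = alone , inj₁-injective eq

    ownLine≡column : ∀ {x b} → ownLine x ≡ inj₂ b → ¬ AloneInRow X x × proj₂ x ≡ b
    ownLine≡column {x} eq with aloneInRow? x
    ... | no ¬alone = ¬alone , inj₂-injective eq

    ownLine-injective : ∀ {x y} → x ∈ X → y ∈ X → ownLine x ≡ ownLine y → x ≡ y
    ownLine-injective {a , b} {a' , b'} x∈X y∈X eq with ownLine (a , b) in ownLine-x
    ... | inj₁ _ with alone-x , refl ← ownLine≡row ownLine-x | _ , refl ← ownLine≡row (sym eq) =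
      cong (a ,_) (sym (alone-x b' y∈X))
    ... | inj₂ _ with ¬alone-x , refl ← ownLine≡column ownLine-x | _ , refl ← ownLine≡column (sym eq) =
      cong (_, b) (sym (aloneInColumn x∈X ¬alone-x a' y∈X))

    Unhit : Line → Set
    Unhit ℓ = All (λ y → ownLine y ≢ ℓ) X

    unhit? : ∀ ℓ → Dec (Unhit ℓ)
    unhit? ℓ = All.all? (λ y → ¬? (≡-dec-⊎ _≟_ _≟_ (ownLine y) ℓ)) X

    row-unhit : ∀ {x} → x ∈ X → ¬ AloneInRow X x → Unhit (inj₁ (proj₁ x))
    row-unhit {a , b} x∈X ¬alone = All.tabulate unhit
      where
      unhit : ∀ {y} → y ∈ X → ownLine y ≢ inj₁ a
      unhit {_ , d} _ eq with alone-y , refl ← ownLine≡row eq =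
        ¬alone λ b' ab'∈X → trans (alone-y b' ab'∈X) (sym (alone-y b x∈X))

    column-unhit : ∀ {x} → x ∈ X → AloneInRow X x → Unhit (inj₂ (proj₂ x))
    column-unhit {a , b} x∈X alone = All.tabulate unhit
      where
      unhit : ∀ {y} → y ∈ X → ownLine y ≢ inj₂ b
      unhit y∈X eq with ¬alone-y , refl ← ownLine≡column eq
                   with refl ← aloneInColumn y∈X ¬alone-y a x∈X = ¬alone-y alone

    columns-unhit : (∀ a → ¬ Unhit (inj₁ a)) → ∀ b → Unhit (inj₂ b)
    columns-unhit rows-hit b =
      All.tabulate λ y∈X eq → rows-hit _ (row-unhit y∈X (proj₁ (ownLine≡column eq)))

    rows-unhit : (∀ b → ¬ Unhit (inj₂ b)) → ∀ a → Unhit (inj₁ a)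
    rows-unhit columns-hit a =
      All.tabulate λ y∈X eq → columns-hit _ (column-unhit y∈X (proj₁ (ownLine≡row eq)))

    two-unhit-lines : 2 ≤ m → 2 ≤ n → Σ Line λ ℓ → Σ Line λ ℓ' → ℓ ≢ ℓ' × Unhit ℓ × Unhit ℓ'
    two-unhit-lines 2≤m 2≤n with any? (unhit? ∘ inj₁) | any? (unhit? ∘ inj₂)
    ... | yes (a , unhit-a) | yes (b , unhit-b) = inj₁ a , inj₂ b , (λ ()) , unhit-a , unhit-b
    ... | no ¬unhit-row | _
      with b , b' , b≢b' ← distinct-elements 2≤n
      = inj₂ b , inj₂ b' , b≢b' ∘ inj₂-injective
      , columns-unhit (λ a unhit → ¬unhit-row (a , unhit)) b
      , columns-unhit (λ a unhit → ¬unhit-row (a , unhit)) b'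
    ... | yes _ | no ¬unhit-column
      with a , a' , a≢a' ← distinct-elements 2≤m
      = inj₁ a , inj₁ a' , a≢a' ∘ inj₁-injective
      , rows-unhit (λ b unhit → ¬unhit-column (b , unhit)) a
      , rows-unhit (λ b unhit → ¬unhit-column (b , unhit)) a'

    lFree⇒length≤ : 2 ≤ m → 2 ≤ n → Unique X → length X ≤ m + n ∸ 2
    lFree⇒length≤ 2≤m 2≤n X!
      with ℓ , ℓ' , ℓ≢ℓ' , unhit-ℓ , unhit-ℓ' ← two-unhit-lines 2≤m 2≤n
      = m+n≤o⇒m≤o∸n (length X) (begin
        length X + 2                         ≡⟨ +-comm (length X) 2 ⟩
        2 + length X                         ≡⟨ cong (2 +_) (length-map ownLine X) ⟨
        length (ℓ ∷ ℓ' ∷ map ownLine X)      ≤⟨ length-≤-of-⊆ lines! (λ {ℓ} _ → ∈-allLines ℓ) ⟩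
        length allLines                      ≡⟨ length-allLines ⟩
        m + n                                ∎)
      where
      open ≤-Reasoning
      lines! : Unique (ℓ ∷ ℓ' ∷ map ownLine X)
      lines! = (ℓ≢ℓ' ∷ All-map⁺ (All.map ≢-sym unhit-ℓ)) ∷ All-map⁺ (All.map ≢-sym unhit-ℓ')
             ∷ unique-map ownLine X! ownLine-injective

  allPoints : List Point
  allPoints = cartesianProduct (allFin m) (allFin n)

  allPoints! : Unique allPoints
  allPoints! = cartesianProduct⁺ (allFin⁺ m) (allFin⁺ n)

  ∈-allPoints : ∀ p → p ∈ allPoints
  ∈-allPoints (a , b) = ∈-cartesianProduct⁺ (∈-allFin a) (∈-allFin b)

  Represents : Matrix m n → List Point → Set
  Represents M X = ∀ {i j} → T (M i j) ⇔ (i , j) ∈ X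

  indicator : List Point → Matrix m n
  indicator X i j = isYes ((i , j) ∈? X)

  indicator-represents : ∀ X → Represents (indicator X) X
  indicator-represents X = mk⇔ toWitness fromWitness

  support : Matrix m n → List Point
  support M = filterᵇ (uncurry M) allPoints

  support! : ∀ M → Unique (support M)
  support! M = filter⁺ (T? ∘ uncurry M) allPoints!

  support-represents : ∀ M → Represents M (support M)
  support-represents M = mk⇔ (∈-filter⁺ (T? ∘ uncurry M) (∈-allPoints _))
                             (proj₂ ∘ ∈-filter⁻ (T? ∘ uncurry M) {xs = allPoints})

  ones-represents : ∀ {M X} → Represents M X → Unique X → ones M ≡ length X
  ones-represents {M} {X} rep X! = begin
    ones M              ≡⟨ length-filterᵇ-cartesianProduct (uncurry M) (allFin m) (allFin n) ⟨
    length (support M)  ≡⟨ length-≡-of-⊆-⊇ (support! M) X! (to rep ∘ from (support-represents M))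
                                                          (to (support-represents M) ∘ from rep) ⟩
    length X            ∎
    where open ≡-Reasoning

  rectFree⇒rectangleFree : ∀ {M X} → Represents M X → RectFree M → RectangleFree X
  rectFree⇒rectangleFree {M} {X} rep rf {i , j} {i' , j'} ij∈X i'j'∈X (i≢i' , j≢j') ij'∈X i'j∈X =
    rf i i' j j' i≢i' j≢j' (entry ij∈X) (entry ij'∈X) (entry i'j∈X) (entry i'j'∈X)
    where
    entry : ∀ {i j} → (i , j) ∈ X → M i j ≡ true
    entry = to T-≡ ∘ from rep

  rectangleFree⇒rectFree : ∀ {M X} → Represents M X → RectangleFree X → RectFree M
  rectangleFree⇒rectFree {M} {X} rep rf i i' j j' i≢i' j≢j' ij ij' i'j i'j' =
    rf (member ij) (member i'j') (i≢i' , j≢j') (member ij') (member i'j)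
    where
    member : ∀ {i j} → M i j ≡ true → (i , j) ∈ X
    member = to rep ∘ from T-≡

  rectangleFree? : ∀ X → Dec (RectangleFree X)
  rectangleFree? X =
    map′ (λ rf u∈X v∈X → All.lookup (All.lookup rf u∈X) v∈X)
         (λ rf → All.tabulate λ u∈X → All.tabulate λ v∈X → rf u∈X v∈X)
         (All.all? (λ u → All.all? (λ v →
           apart? u v →-dec (corner u v zero ∈? X →-dec ¬? (corner u v (suc zero) ∈? X))) X) X)

  rectangleFree-⊆ : ∀ {X Y} → X ⊆ Y → RectangleFree Y → RectangleFree X
  rectangleFree-⊆ X⊆Y rf u∈X v∈X uv c₀∈X = rf (X⊆Y u∈X) (X⊆Y v∈X) uv (X⊆Y c₀∈X) ∘ X⊆Y

  longest-rectangleFree⇒isZ : ∀ {X} → Longest RectangleFree X → IsZ m n (length X)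
  longest-rectangleFree⇒isZ {X} (X! , rfX , X-longest) =
      (indicator X , rectangleFree⇒rectFree (indicator-represents X) rfX , ones-represents (indicator-represents X) X!)
    , λ M rfM → begin
        ones M              ≡⟨ ones-represents (support-represents M) (support! M) ⟩
        length (support M)  ≤⟨ X-longest (support M) (support! M) (rectFree⇒rectangleFree (support-represents M) rfM) ⟩
        length X            ∎
    where open ≤-Reasoning

  longest-rectangleFree⇒isFmu₀ : ∀ {X} → Longest RectangleFree X → IsFmu Rook 0 (length X)
  longest-rectangleFree⇒isFmu₀ {X} (X! , rfX , X-longest) =
    (X , X! , rectangleFree⇒ftmv₀ rfX , refl) , λ Y Y! ftmvY → X-longest Y Y! (ftmv⇒rectangleFree ftmvY)

  isZ×isFmu₀ : Σ ℕ λ z → IsZ m n z × IsFmu Rook 0 z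
  isZ×isFmu₀ with X , X-longest ← longest _≟ₚ_ allPoints! ∈-allPoints rectangleFree? rectangleFree-⊆ (λ ()) =
    length X , longest-rectangleFree⇒isZ X-longest , longest-rectangleFree⇒isFmu₀ X-longest

  row : Fin m → List Point
  row a = map (a ,_) (allFin n)

  column : Fin n → List Point
  column b = map (_, b) (allFin m)

  row! : ∀ a → Unique (row a)
  row! a = map⁺ (cong proj₂) (allFin⁺ n)

  column! : ∀ b → Unique (column b)
  column! b = map⁺ (cong proj₁) (allFin⁺ m)

  row-noApartPair : ∀ a → NoApartPair (row a)
  row-noApartPair a u∈ v∈ (a≢a , _)
    with _ , _ , refl ← ∈-map⁻ (a ,_) u∈ | _ , _ , refl ← ∈-map⁻ (a ,_) v∈ = a≢a refl

  column-noApartPair : ∀ b → NoApartPair (column b)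
  column-noApartPair b u∈ v∈ (_ , b≢b)
    with _ , _ , refl ← ∈-map⁻ (_, b) u∈ | _ , _ , refl ← ∈-map⁻ (_, b) v∈ = b≢b refl

  isFmu₂₊ : Fin m → Fin n → ∀ k → IsFmu Rook (2 + k) (m ⊔ n)
  isFmu₂₊ a b k = longest-line , λ Y Y! ftmvY → noApartPair⇒length≤ Y! (ftmv⇒noApartPair ftmvY)
    where
    longest-line : Σ (List Point) λ X → Unique X × IsFTMV Rook (2 + k) X × length X ≡ m ⊔ n
    longest-line with ⊔-sel m n
    ... | inj₁ m⊔n≡m = column b , column! b , noApartPair⇒ftmv (column-noApartPair b)
                     , trans (trans (length-map (_, b) (allFin m)) (length-allFin m)) (sym m⊔n≡m)
    ... | inj₂ m⊔n≡n = row a , row! a , noApartPair⇒ftmv (row-noApartPair a)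
                     , trans (trans (length-map (a ,_) (allFin n)) (length-allFin n)) (sym m⊔n≡n)

module Cross (m n : ℕ) where
  open RookGraph (suc m) (suc n)

  cross : List Point
  cross = map (λ i → suc i , zero) (allFin m) ++ map (λ j → zero , suc j) (allFin n)

  ∈-cross⁻ : ∀ {x} → x ∈ cross → (∃ λ i → x ≡ (suc i , zero)) ⊎ (∃ λ j → x ≡ (zero , suc j))
  ∈-cross⁻ x∈ with ∈-++⁻ (map (λ i → suc i , zero) (allFin m)) x∈
  ... | inj₁ x∈rows    with i , _ , eq ← ∈-map⁻ _ x∈rows    = inj₁ (i , eq)
  ... | inj₂ x∈columns with j , _ , eq ← ∈-map⁻ _ x∈columns = inj₂ (j , eq)

  cross! : Unique cross
  cross! = ++⁺ (map⁺ (suc-injective ∘ cong proj₁) (allFin⁺ m)) (map⁺ (suc-injective ∘ cong proj₂) (allFin⁺ n))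
               disjoint
    where
    disjoint : ∀ {x} → ¬ (x ∈ map (λ i → suc i , zero) (allFin m) × x ∈ map (λ j → zero , suc j) (allFin n))
    disjoint (x∈rows , x∈columns) with _ , _ , refl ← ∈-map⁻ _ x∈rows with _ , _ , () ← ∈-map⁻ _ x∈columns

  cross-alone : ∀ {x} → x ∈ cross → AloneInRow cross x ⊎ AloneInColumn cross x
  cross-alone x∈ with ∈-cross⁻ x∈
  ... | inj₁ (i , refl) = inj₁ alone
    where
    alone : AloneInRow cross (suc i , zero)
    alone _ y∈ with ∈-cross⁻ y∈
    ... | inj₁ (_ , refl) = refl
  ... | inj₂ (j , refl) = inj₂ alone
    where
    alone : AloneInColumn cross (zero , suc j)
    alone _ y∈ with ∈-cross⁻ y∈
    ... | inj₂ (_ , refl) = refl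

  length-cross : length cross ≡ m + n
  length-cross = begin
    length cross
      ≡⟨ length-++ (map (λ i → suc i , zero) (allFin m)) ⟩
    length (map (λ i → suc i , zero) (allFin m)) + length (map (λ j → zero , suc j) (allFin n))
      ≡⟨ cong₂ _+_ (length-map _ (allFin m)) (length-map _ (allFin n)) ⟩
    length (allFin m) + length (allFin n)
      ≡⟨ cong₂ _+_ (length-allFin m) (length-allFin n) ⟩
    m + n
      ∎
    where open ≡-Reasoning

  isFmu₁ : 2 ≤ suc m → 2 ≤ suc n → IsFmu Rook 1 (suc m + suc n ∸ 2)
  isFmu₁ 2≤m 2≤n =
      (cross , cross! , lFree⇒ftmv₁ (alone⇒lFree cross-alone) , trans length-cross (sym (cong (_∸ 1) (+-suc m n))))
    , λ Y Y! ftmvY → lFree⇒length≤ (ftmv⇒lFree ftmvY) 2≤m 2≤n Y!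

theorem7p1 : ∀ (m n : ℕ) → 2 ≤ m → 2 ≤ n →
    Σ ℕ (λ z → IsZ m n z × IsFmu (K m □ K n) 0 z)
  × IsFmu (K m □ K n) 1 (m + n ∸ 2)
  × (∀ (k : ℕ) → 2 ≤ k → IsFmu (K m □ K n) k (m ⊔ n))
theorem7p1 (suc m) (suc n) 2≤m 2≤n =
    RookGraph.isZ×isFmu₀ (suc m) (suc n)
  , Cross.isFmu₁ m n 2≤m 2≤n
  , λ { (suc (suc k)) _ → RookGraph.isFmu₂₊ (suc m) (suc n) zero zero k ; 1 (s≤s ()) }
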